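{- Let $k\geq 1$, let $G$ be any finite (multi)graph and run the procedure STRIP on $G$. At the beginning of every iteration of the main loop of STRIP: (a) if $u\in W_1$ then $u$ has no neighbours in $W_1\setminus Q$; (b) if $u\in R\cap Q$ then $u$ has no neighbours in $W_1\setminus Q$; (c) if $u\in R\setminus Q$ then $u$ has at most one neighbour in $W_1$.
   Context: Let $n=|V(G)|$ and $\beta=e^{ -k/200}$. The $k$-core $C$ of $G$ is its maximal subgraph of minimum degree at least $k$. Procedure STRIP starts from $C$. At every moment the vertices of the remaining graph are partitioned into: $W_0$, the remaining vertices that had degree exactly $k$ in $C$; $W_1$, the remaining vertices not in $W_0$ whose current degree is at most $k$; $R$, the remaining vertices of current degree greater than $k$. A vertex $v$ is deletable if in $C$: (D1) $\deg(v)>2k$, or (D2) $v\notin W_0$ and $v$ has at least $k/2$ neighbours in $W_0$; or if in the current remaining graph: (D3) $\deg(v)<k$, or (D4) $v\in R$ and $v$ has at least two neighbours in $W_1$, or (D5) $v\in W_1$ and $v$ has a neighbour that is either in $R$ and deletable, or in $W_1$. (D6) Once a vertex becomes deletable it stays deletable. $Q$ is the set of deletable vertices not yet removed. Step 1: start with $C$ and let $Q$ be the set of vertices satisfying (D1) or (D2). Step 2: until $Q=\emptyset$ or $\beta n$ iterations have been run, let $v$ be the first vertex of $Q$ in a fixed vertex ordering; (a) remove $v$ from the graph and from $Q$; (b) each neighbour $u$ of $v$ in $R$ whose degree is now at most $k$ moves from $R$ to $W_1$; (c) each vertex $w\notin Q$ that is now deletable is placed into $Q$. Vertices placed in $Q$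 stay in whichever of $W_0,W_1,R$ they are in. For multigraphs, degrees and neighbour counts are taken with multiplicity. -}

module Defs where

open import Data.Nat using (ℕ; zero; suc; _+_; _*_; _≤_; _≤ᵇ_; _<ᵇ_; _≡ᵇ_)
open import Data.Bool using (Bool; true; false; _∧_; _∨_; not; if_then_else_)
open import Data.Fin using (Fin; zero; suc; _≟_)
open import Relation.Nullary.Decidable using (⌊_⌋)
open import Data.Maybe using (Maybe; just; nothing)
import Data.Maybe as Maybe
open import Data.Product using (Σ; ∃; _×_; _,_)
open import Relation.Binary.PropositionalEquality using (_≡_)

-- Finite multigraphs on vertex set Fin n.
-- adj u v = number of edges between u and v (with multiplicity);
-- adj v v = number of loop-ends at v (twice the number of loops), so
-- that deg v = Σ_u adj v u counts loops twice, as usual.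

record Multigraph (n : ℕ) : Set where
  field
    adj      : Fin n → Fin n → ℕ
    adj-sym  : ∀ u v → adj u v ≡ adj v u
    loopEven : ∀ v → ∃ λ m → adj v v ≡ 2 * m

open Multigraph public

sumFin : ∀ {n} → (Fin n → ℕ) → ℕ
sumFin {zero}  f = 0
sumFin {suc n} f = f zero + sumFin (λ i → f (suc i))

VSet : ℕ → Set
VSet n = Fin n → Bool

module _ {n : ℕ} (G : Multigraph n) where

  nbrsIn : VSet n → Fin n → ℕ
  nbrsIn P v = sumFin (λ u → if P u then adj G v u else 0)

  -- degree of v in the subgraph induced by X (meaningful for v ∈ X)
  degIn : VSet n → Fin n → ℕ
  degIn X v = nbrsIn X v

  MinDegAtLeast : ℕ → VSet n → Set
  MinDegAtLeast k X = ∀ v → X v ≡ true → k ≤ degIn X v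

  IsKCore : ℕ → VSet n → Set
  IsKCore k C = MinDegAtLeast k C
              × (∀ (S : VSet n) → MinDegAtLeast k S → ∀ v → S v ≡ true → C v ≡ true)

first : ∀ {n} → VSet n → Maybe (Fin n)
first {zero}  P = nothing
first {suc n} P = if P zero then just zero else Maybe.map suc (first (λ i → P (suc i)))

-- State: the set of remaining vertices, and the set of vertices that
-- have (at some point) become deletable (deletability is sticky, (D6)).
record State (n : ℕ) : Set where
  constructor st
  field
    alive : VSet n
    del   : VSet n

open State public

module STRIP {n : ℕ} (k : ℕ) (G : Multigraph n) (C : VSet n) where

  degC : Fin n → ℕ
  degC = degIn G C

  inW0C : VSet n
  inW0C v = C v ∧ (degC v ≡ᵇ k)

  D1 : VSet n
  D1 v = C v ∧ (2 * k <ᵇ degC v)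

  D2 : VSet n
  D2 v = C v ∧ not (inW0C v) ∧ (k ≤ᵇ 2 * nbrsIn G (λ u → C u ∧ inW0C u) v)

  module Current (s : State n) where
    X : VSet n
    X = alive s

    deg : Fin n → ℕ
    deg = degIn G X

    W0 : VSet n
    W0 v = X v ∧ (degC v ≡ᵇ k)

    W1 : VSet n
    W1 v = X v ∧ not (W0 v) ∧ (deg v ≤ᵇ k)

    R : VSet n
    R v = X v ∧ (k <ᵇ deg v)

    Q : VSet n
    Q v = X v ∧ del s v

    nbrs : VSet n → Fin n → ℕ
    nbrs P v = nbrsIn G (λ u → X u ∧ P u) v

    D3 : VSet n
    D3 v = X v ∧ (deg v <ᵇ k)

    D4 : VSet n
    D4 v = R v ∧ (2 ≤ᵇ nbrs W1 v)

  -- Deletability after a removal: previously deletable (D6) or (D1)-(D4);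
  -- then (D5), whose condition refers to deletable vertices in R (which can
  -- only be deletable by (D1)-(D4),(D6)), so this is the full closure.
  updateDel : State n → VSet n
  updateDel s v = X v ∧ (delR v ∨ (W1 v ∧ (1 ≤ᵇ nbrs (λ u → (R u ∧ delR u) ∨ W1 u) v)))
    where
      open Current s
      delR : VSet n
      delR u = del s u ∨ D1 u ∨ D2 u ∨ D3 u ∨ D4 u

  initial : State n
  initial = st C (λ v → C v ∧ (D1 v ∨ D2 v))

  -- one iteration of Step 2 (if Q is empty the procedure has stopped)
  step : State n → State n
  step s with first (Current.Q s)
  ... | nothing = s
  ... | just v  = st alive' (λ w → del s w ∨ updateDel (st alive' (del s)) w)
    where
      alive' : VSet n
      alive' w = alive s w ∧ not ⌊ w ≟ v ⌋

  -- state at the beginning of iteration t (t iterations already performed)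
  run : ℕ → State n
  run zero    = initial
  run (suc t) = step (run t)

  Begins : ℕ → Set
  Begins t = ∀ j → j ≤ t → ∃ λ v → Current.Q (run j) v ≡ true

-- The three claims form an invariant of the main loop; after a removal they
-- are re-established without even using the previous state's invariant:
--
--  * In the initial state W₁ is empty: C has minimum degree ≥ k, so a vertex
--    of current degree ≤ k has degree exactly k in C and lies in W₀.
--    Hence (a), (b), (c) hold vacuously.
--  * After every removal the deletable set is recomputed and is therefore
--    closed under rules (D4) and (D5).  Closure under (D5) puts every
--    W₁-neighbour of a W₁-vertex, and of a deletable R-vertex, into Q; this
--    gives (a) and (b), since an R-vertex in Q was made deletable by a rule
--    other than (D5) (it is not in W₁).  Closure under (D4) gives (c).
module Submission where

open import Defs
open import Data.Nat using (ℕ; zero; suc; _+_; _≤_; _≤ᵇ_; _<ᵇ_; z≤n; s≤s; s≤s⁻¹)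
open import Data.Nat.Properties
  using (≤-trans; ≤-reflexive; ≤-antisym; m≤m+n; m≤n+m; ≰⇒>; <⇒≱;
         ≤ᵇ⇒≤; ≤⇒≤ᵇ; <ᵇ⇒<; ≡⇒≡ᵇ)
open import Data.Bool using (true; false; _∧_; _∨_; not; if_then_else_)
open import Data.Bool.Properties using (T-≡; ∧-conicalˡ; ∧-conicalʳ)
open import Data.Fin using (Fin; zero; suc)
open import Data.Fin.Properties using (_≟_)
open import Data.Maybe using (just; nothing)
open import Data.Product using (_×_; _,_; proj₁)
open import Data.Sum using (_⊎_; inj₁; inj₂)
open import Data.Empty using (⊥; ⊥-elim)
open import Function.Bundles using (Equivalence)
open import Relation.Nullary.Decidable using (⌊_⌋)
open import Relation.Binary.PropositionalEquality
  using (_≡_; refl; cong₂; subst)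

∧-intro : ∀ {a b} → a ≡ true → b ≡ true → a ∧ b ≡ true
∧-intro refl refl = refl

∨-introˡ : ∀ {a} b → a ≡ true → a ∨ b ≡ true
∨-introˡ _ refl = refl

∨-introʳ : ∀ a {b} → b ≡ true → a ∨ b ≡ true
∨-introʳ true  _ = refl
∨-introʳ false h = h

∨-elim : ∀ a {b} → a ∨ b ≡ true → a ≡ true ⊎ b ≡ true
∨-elim true  _ = inj₁ refl
∨-elim false h = inj₂ h

not-both : ∀ {b} → not b ≡ true → b ≡ true → ⊥
not-both () refl

true≢false : ∀ {b} → b ≡ true → b ≡ false → ⊥
true≢false refl ()

≤ᵇ-sound : ∀ m n → (m ≤ᵇ n) ≡ true → m ≤ n
≤ᵇ-sound m n h = ≤ᵇ⇒≤ m n (Equivalence.from T-≡ h)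

≤ᵇ-complete : ∀ {m n} → m ≤ n → (m ≤ᵇ n) ≡ true
≤ᵇ-complete p = Equivalence.to T-≡ (≤⇒≤ᵇ p)

<ᵇ-sound : ∀ m n → (m <ᵇ n) ≡ true → suc m ≤ n
<ᵇ-sound m n h = <ᵇ⇒< m n (Equivalence.from T-≡ h)

not-2≤ᵇ⇒≤1 : ∀ {m} → (2 ≤ᵇ m) ≡ false → m ≤ 1
not-2≤ᵇ⇒≤1 h = s≤s⁻¹ (≰⇒> λ 2≤m → true≢false (≤ᵇ-complete 2≤m) h)

sumFin-zero : ∀ {n} (f : Fin n → ℕ) → (∀ i → f i ≡ 0) → sumFin f ≡ 0
sumFin-zero {zero}  f h = refl
sumFin-zero {suc n} f h = cong₂ _+_ (h zero) (sumFin-zero (λ i → f (suc i)) (λ i → h (suc i)))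

term≤sumFin : ∀ {n} (f : Fin n → ℕ) i → f i ≤ sumFin f
term≤sumFin f zero    = m≤m+n (f zero) _
term≤sumFin f (suc i) = ≤-trans (term≤sumFin (λ j → f (suc j)) i) (m≤n+m _ (f zero))

module Neighbours {n : ℕ} (G : Multigraph n) where

  adj≤nbrsIn : ∀ P v u → P u ≡ true → adj G v u ≤ nbrsIn G P v
  adj≤nbrsIn P v u Pu =
    subst (_≤ nbrsIn G P v) (cond-true Pu)
          (term≤sumFin (λ w → if P w then adj G v w else 0) u)
    where
      cond-true : ∀ {b} → b ≡ true → (if b then adj G v u else 0) ≡ adj G v u
      cond-true refl = refl

  nbrsIn-none : ∀ P v → (∀ u → 1 ≤ adj G v u → P u ≡ true → ⊥) → nbrsIn G P v ≡ 0
  nbrsIn-none P v none = sumFin-zero _ λ u → term-zero (P u) (adj G v u) (none u)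
    where
      term-zero : ∀ b m → (1 ≤ m → b ≡ true → ⊥) → (if b then m else 0) ≡ 0
      term-zero false m _    = refl
      term-zero true  zero _ = refl
      term-zero true  (suc m) h = ⊥-elim (h (s≤s z≤n) refl)

module Invariant (k : ℕ) {n : ℕ} (G : Multigraph n) (C : VSet n) where
  open STRIP k G C
  open Neighbours G

  Inv : State n → Set
  Inv s = let open Current s in
      (∀ u → W1 u ≡ true → nbrs (λ w → W1 w ∧ not (Q w)) u ≡ 0)
    × (∀ u → R u ∧ Q u ≡ true → nbrs (λ w → W1 w ∧ not (Q w)) u ≡ 0)
    × (∀ u → R u ∧ not (Q u) ≡ true → nbrs W1 u ≤ 1)

  -- R and W₁ are disjoint: their degree conditions  > k  and  ≤ k  clash
  R⇒¬W1 : ∀ s u → Current.R s u ≡ true → Current.W1 s u ≡ false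
  R⇒¬W1 s u Ru with Current.W1 s u in W1u
  ... | false = refl
  ... | true  = ⊥-elim (<⇒≱ large small)
    where
      open Current s using (X; W0; deg)
      large : suc k ≤ deg u
      large = <ᵇ-sound k (deg u) (∧-conicalʳ (X u) _ Ru)
      small : deg u ≤ k
      small = ≤ᵇ-sound (deg u) k (∧-conicalʳ (not (W0 u)) _ (∧-conicalʳ (X u) _ W1u))

  -- In the initial state W₁ is empty: by minimum degree ≥ k in C, a vertex
  -- of degree ≤ k has degree exactly k in C and so belongs to W₀.
  initial-W1-empty : MinDegAtLeast G k C → ∀ v → Current.W1 initial v ≡ false
  initial-W1-empty minDeg v with Current.W1 initial v in W1v
  ... | false = refl
  ... | true  = ⊥-elim (not-both notW0 W0v)
    where
      open Current initial using (W0)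
      Cv : C v ≡ true
      Cv = ∧-conicalˡ (C v) _ W1v
      notW0 : not (W0 v) ≡ true
      notW0 = ∧-conicalˡ (not (W0 v)) _ (∧-conicalʳ (C v) _ W1v)
      small : (degC v ≤ᵇ k) ≡ true
      small = ∧-conicalʳ (not (W0 v)) _ (∧-conicalʳ (C v) _ W1v)
      W0v : W0 v ≡ true
      W0v = ∧-intro Cv (Equivalence.to T-≡
              (≡⇒≡ᵇ _ _ (≤-antisym (≤ᵇ-sound (degC v) k small) (minDeg v Cv))))

  initial-Inv : MinDegAtLeast G k C → Inv initial
  initial-Inv minDeg =
      (λ u W1u → ⊥-elim (true≢false W1u (noW1 u)))
    , (λ u _ → nbrsIn-none _ u λ w _ h →
         true≢false (∧-conicalˡ (Current.W1 initial w) _ (∧-conicalʳ (C w) _ h)) (noW1 w))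
    , (λ u _ → ≤-trans (≤-reflexive (nbrsIn-none _ u λ w _ h →
         true≢false (∧-conicalʳ (C w) _ h) (noW1 w))) z≤n)
    where
      noW1 : ∀ v → Current.W1 initial v ≡ false
      noW1 = initial-W1-empty minDeg

  -- The state after a removal: on the remaining set, deletability is
  -- recomputed by  updateDel , which saturates it under (D1)–(D5).
  saturate : State n → State n
  saturate s = st (alive s) (λ w → del s w ∨ updateDel s w)

  module Saturated (s : State n) where
    open Current s

    -- the queue after saturation (the remaining set, hence X, W₁, R, is unchanged)
    Q′ : VSet n
    Q′ = Current.Q (saturate s)

    -- deletable by (D1)–(D4) or (D6); the same predicate as in  updateDel
    deletableR : VSet n
    deletableR u = del s u ∨ D1 u ∨ D2 u ∨ D3 u ∨ D4 u

    D5-closed : ∀ u w → W1 w ≡ true → 1 ≤ adj G w u →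
                X u ∧ ((R u ∧ deletableR u) ∨ W1 u) ≡ true → Q′ w ≡ true
    D5-closed u w W1w edge trigger =
      ∧-intro Xw (∨-introʳ (del s w) (∧-intro Xw (∨-introʳ (deletableR w)
        (∧-intro W1w (≤ᵇ-complete (≤-trans edge (adj≤nbrsIn _ w u trigger)))))))
      where
        Xw : X w ≡ true
        Xw = ∧-conicalˡ (X w) _ W1w

    D4-closed : ∀ u → R u ≡ true → (2 ≤ᵇ nbrs W1 u) ≡ true → Q′ u ≡ true
    D4-closed u Ru twoW1 =
      ∧-intro Xu (∨-introʳ (del s u) (∧-intro Xu (∨-introˡ _
        (∨-introʳ (del s u) (∨-introʳ (D1 u) (∨-introʳ (D2 u) (∨-introʳ (D3 u)
          (∧-intro Ru twoW1))))))))
      where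
        Xu : X u ≡ true
        Xu = ∧-conicalˡ (X u) _ Ru

    -- an R-vertex in Q′ was not made deletable by (D5), which needs W₁
    RQ′⇒deletableR : ∀ u → R u ∧ Q′ u ≡ true → deletableR u ≡ true
    RQ′⇒deletableR u h with ∨-elim (del s u) (∧-conicalʳ (X u) _ (∧-conicalʳ (R u) _ h))
    ... | inj₁ delu = ∨-introˡ _ delu
    ... | inj₂ upd with ∨-elim (deletableR u) (∧-conicalʳ (X u) _ upd)
    ...   | inj₁ dR  = dR
    ...   | inj₂ W1z = ⊥-elim (true≢false (∧-conicalˡ (W1 u) _ W1z)
                                (R⇒¬W1 s u (∧-conicalˡ (R u) _ h)))

    no-unqueued-W1 : ∀ u → X u ∧ ((R u ∧ deletableR u) ∨ W1 u) ≡ true →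
                     nbrs (λ w → W1 w ∧ not (Q′ w)) u ≡ 0
    no-unqueued-W1 u trigger = nbrsIn-none _ u λ w edge h →
      let W1w = ∧-conicalˡ (W1 w) _ (∧-conicalʳ (X w) _ h)
      in not-both (∧-conicalʳ (W1 w) _ (∧-conicalʳ (X w) _ h))
                  (D5-closed u w W1w (subst (1 ≤_) (adj-sym G u w) edge) trigger)

    -- (a) and (b) from closure under (D5), (c) from closure under (D4)
    saturate-Inv : Inv (saturate s)
    saturate-Inv =
        (λ u W1u → no-unqueued-W1 u
           (∧-intro (∧-conicalˡ (X u) _ W1u) (∨-introʳ (R u ∧ deletableR u) W1u)))
      , (λ u h → let Ru = ∧-conicalˡ (R u) _ h in
           no-unqueued-W1 u (∧-intro (∧-conicalˡ (X u) _ Ru)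
             (∨-introˡ _ (∧-intro Ru (RQ′⇒deletableR u h)))))
      , λ u h → at-most-one u (∧-conicalˡ (R u) _ h) (∧-conicalʳ (R u) _ h) _ refl
      where
        at-most-one : ∀ u → R u ≡ true → not (Q′ u) ≡ true →
                      ∀ b → (2 ≤ᵇ nbrs W1 u) ≡ b → nbrs W1 u ≤ 1
        at-most-one u Ru notQ false few  = not-2≤ᵇ⇒≤1 few
        at-most-one u Ru notQ true  many = ⊥-elim (not-both notQ (D4-closed u Ru many))

  step-Inv : ∀ s → Inv s → Inv (step s)
  step-Inv s inv with first (Current.Q s)
  ... | nothing = inv
  ... | just v  = Saturated.saturate-Inv (st (λ w → alive s w ∧ not ⌊ w ≟ v ⌋) (del s))

  run-Inv : MinDegAtLeast G k C → ∀ t → Inv (run t)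
  run-Inv minDeg zero    = initial-Inv minDeg
  run-Inv minDeg (suc t) = step-Inv (run t) (run-Inv minDeg t)

mainTheorem4 : (k : ℕ) → 1 ≤ k → (n : ℕ) → (G : Multigraph n) → (C : VSet n) →
    IsKCore G k C → (t : ℕ) → STRIP.Begins k G C t →
    let open STRIP.Current k G C (STRIP.run k G C t) in
      (∀ u → W1 u ≡ true → nbrs (λ w → W1 w ∧ not (Q w)) u ≡ 0)
      × (∀ u → R u ∧ Q u ≡ true → nbrs (λ w → W1 w ∧ not (Q w)) u ≡ 0)
      × (∀ u → R u ∧ not (Q u) ≡ true → nbrs W1 u ≤ 1)
mainTheorem4 k _ n G C core t _ = Invariant.run-Inv k G C (proj₁ core) t
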